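{- Let $k\ge 2$, $n=k+1$, and let $A,B$ be sets with $|A|=k$ and $|B|\ge 2$. Then there exist functions $f\colon A^n\to B$ and $f^*\colon A^\sharp\to B$ such that $f_I\equiv f^*\circ\mathrm{ofo}|_{A^{n-1}}$ for every $2$-element subset $I$ of $\{1,\dots,n\}$, but $f$ is not equivalent to any $n$-ary function $A^n\to B$ determined by the order of first occurrence; moreover, if $k>2$, then $\mathrm{Inv} f=\{\mathrm{id}\}$, and hence $f$ is not $2$-set-transitive.
   Context: For $\mathbf{a}=(a_1,\dots,a_n)\in A^n$ and $\tau\colon\{1,\dots,m\}\to\{1,\dots,n\}$, $\mathbf{a}\tau=(a_{\tau(1)},\dots,a_{\tau(m)})$. For a $2$-element subset $I\subseteq\{1,\dots,n\}$, $\delta_I\colon\{1,\dots,n\}\to\{1,\dots,n-1\}$ is given by $\delta_I(i)=i$ if $i<\max I$, $\delta_I(i)=\min I$ if $i=\max I$, $\delta_I(i)=i-1$ if $i>\max I$, and the identification minor $f_I\colon A^{n-1}\to B$ is $f_I(\mathbf{a})=f(\mathbf{a}\delta_I)$. A function $g\colon A^p\to B$ is a minor of $h\colon A^q\to B$ if there is a map $\tau\colon\{1,\dots,q\}\to\{1,\dots,p\}$ with $g(\mathbf{a})=h(\mathbf{a}\tau)$ for all $\mathbf{a}\in A^p$; $g\equiv h$ (equivalent) means each is a minor of the other (for functions of the same arity $p$ this means $g(\mathbf a)=h(\mathbf a\sigma)$ for some $\sigma\in S_p$). $A^*=\bigcup_{r\ge0}A^r$; $A^\sharp$ is the set of all tuples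 (of any length) with pairwise distinct entries; $\mathrm{ofo}\colon A^*\to A^\sharp$ lists the distinct entries of a tuple in order of first occurrence. A function $g\colon A^p\to B$ is determined by the order of first occurrence if $g=g^*\circ\mathrm{ofo}|_{A^p}$ for some $g^*\colon A^\sharp\to B$. $\mathrm{Inv}f=\{\sigma\in S_n: f(\mathbf a)=f(\mathbf a\sigma)\ \forall\mathbf a\in A^n\}$; $f$ is $2$-set-transitive if $\mathrm{Inv}f$ acts transitively on the $2$-element subsets of $\{1,\dots,n\}$. -}

module Defs where

open import Data.Nat using (ℕ; suc)
open import Data.Fin as Fin using (Fin; punchOut; _<_)
open import Data.Fin.Properties using (<⇒≢)
open import Data.Fin.Permutation using (Permutation′; _⟨$⟩ʳ_)
open import Data.List using (List; deduplicate)
open import Data.List.Relation.Unary.Unique.Propositional using (Unique)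
import Data.List.Relation.Unary.Unique.DecPropositional.Properties as UP
open import Data.Vec.Functional using (toList)
open import Data.Product using (Σ; ∃; _×_; _,_)
open import Data.Sum using (_⊎_)
open import Function using (_∘_; _↔_; Inverse)
open import Relation.Binary.Definitions using (DecidableEquality)
open import Relation.Binary.PropositionalEquality using (_≡_; _≢_; refl; sym; trans; cong)
open import Relation.Nullary using (yes; no; ¬_)
open import Relation.Nullary.Decidable using (map′)

Tuple : Set → ℕ → Set
Tuple A n = Fin n → A

_·_ : {A : Set} {m n : ℕ} → Tuple A n → (Fin m → Fin n) → Tuple A m
a · τ = a ∘ τ

-- A 2-element subset I = {i , j} of {1..n+1} is given by i < j (i = min I, j = max I).
-- δ_I : Fin (suc n) → Fin n ; δ_I(x) = x if x < j, i if x = j, x-1 if x > j.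
δ : {n : ℕ} (i j : Fin (suc n)) → i < j → Fin (suc n) → Fin n
δ i j i<j x with x Fin.≟ j
... | yes _  = punchOut {i = j} {j = i} (λ e → <⇒≢ i<j (sym e))
... | no x≢j = punchOut {i = j} {j = x} (λ e → x≢j (sym e))

identMinor : {A B : Set} {n : ℕ} → (Tuple A (suc n) → B) →
             (i j : Fin (suc n)) → i < j → Tuple A n → B
identMinor f i j i<j a = f (a · δ i j i<j)

IsMinorOf : {A B : Set} {p q : ℕ} → (Tuple A p → B) → (Tuple A q → B) → Set
IsMinorOf {A} {p = p} {q = q} g h =
  Σ (Fin q → Fin p) λ τ → ∀ (a : Tuple A p) → g a ≡ h (a · τ)

Equivalent : {A B : Set} {p q : ℕ} → (Tuple A p → B) → (Tuple A q → B) → Set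
Equivalent g h = IsMinorOf g h × IsMinorOf h g

Sharp : Set → Set
Sharp A = Σ (List A) Unique

ofo : {A : Set} → DecidableEquality A → {p : ℕ} → Tuple A p → Sharp A
ofo _≟_ a = deduplicate _≟_ (toList a) , UP.deduplicate-! _≟_ (toList a)

DeterminedByOfo : {A B : Set} → DecidableEquality A → {p : ℕ} → (Tuple A p → B) → Set
DeterminedByOfo {A} {B} _≟_ g = Σ (Sharp A → B) λ g* → ∀ a → g a ≡ g* (ofo _≟_ a)

InInv : {A B : Set} {n : ℕ} → (Tuple A n → B) → Permutation′ n → Set
InInv f σ = ∀ a → f a ≡ f (a · (σ ⟨$⟩ʳ_))

InvTrivial : {A B : Set} {n : ℕ} → (Tuple A n → B) → Set
InvTrivial {n = n} f = ∀ (σ : Permutation′ n) → InInv f σ → ∀ x → σ ⟨$⟩ʳ x ≡ x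

MapsPair : {n : ℕ} → Permutation′ n → (i j i' j' : Fin n) → Set
MapsPair σ i j i' j' =
  ((σ ⟨$⟩ʳ i ≡ i') × (σ ⟨$⟩ʳ j ≡ j')) ⊎ ((σ ⟨$⟩ʳ i ≡ j') × (σ ⟨$⟩ʳ j ≡ i'))

TwoSetTransitive : {A B : Set} {n : ℕ} → (Tuple A n → B) → Set
TwoSetTransitive {n = n} f =
  ∀ (i j i' j' : Fin n) → i < j → i' < j' →
    Σ (Permutation′ n) λ σ → InInv f σ × MapsPair σ i j i' j'

decEqVia : {A : Set} {k : ℕ} → A ↔ Fin k → DecidableEquality A
decEqVia e x y =
  map′ (λ p → trans (sym (strictlyInverseʳ x)) (trans (cong from p) (strictlyInverseʳ y)))
       (cong to) (to x Fin.≟ to y)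
  where open Inverse e

-- Identify A with Fin k and call an n-tuple special if it is 0 at exactly two positions i < j and takes the
-- values 1, ..., k-1 in increasing order elsewhere; f is the indicator of the special tuples. A special tuple
-- agreeing at i and j has its zeros there, so f_I is the indicator of the single k-tuple that moves 0 to
-- position i; up to that permutation this is the tuple (0, ..., k-1), whence f_I ≡ f* ∘ ofo for the indicator
-- f* of (0, ..., k-1).
-- An f equivalent to some g determined by ofo would satisfy f(a) = g*(ofo(a τ)). Replacing the value at
-- position q of a special tuple with zeros at q and r by a third value leaves a single zero, so f changes, yet
-- ofo(a τ) does not: either τ misses q, or τ is a bijection reading q last, and both values found there occur
-- earlier.
-- Finally an invariance σ of f preserves special tuples; comparing one whose zeros avoid σx and σy with its
-- image under σ shows that σ is increasing, hence the identity (this needs a fourth position, i.e. k > 2).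

module Submission where

open import Defs
open import Data.Nat using (ℕ; suc; _≤_; _<_)
open import Data.Fin using (Fin) renaming (_<_ to _<ᶠ_)
open import Data.Product using (Σ; _×_)
open import Function using (_∘_; _↔_)
open import Relation.Binary.PropositionalEquality using (_≢_)
open import Relation.Nullary using (¬_)

open import Data.Bool using (Bool; true; false; if_then_else_)
open import Data.Empty using (⊥)
open import Data.Fin as Fin
  using (zero; suc; punchIn; punchOut; inject₁; fromℕ; lower₁; _≟_; _<?_) renaming (_≤_ to _≤ᶠ_)
open import Data.Fin.Induction using (<-weakInduction)
open import Data.Fin.Permutation using (Permutation′; insert; id; _⟨$⟩ʳ_; _⟨$⟩ˡ_; inverseˡ; inverseʳ)
open import Data.Fin.Properties
  using (any?; all?; ¬∀⟶∃¬; <-cmp; <-irrefl; <-asym; <-irrelevant; <⇒≢; ≤∧≢⇒<; toℕ-injective; toℕ-inject₁;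
         toℕ-fromℕ; ≤̄⇒inject₁<; inject₁-lower₁; fromℕ≢inject₁; injective⇒≤; punchOut-mono-≤; punchOut-injective;
         punchOut-cong; punchOut-punchIn; punchInᵢ≢i)
open import Data.List using (List; []; _∷_; _∷ʳ_; _++_; filter; deduplicate; length; lookup; tabulate)
open import Data.List.Properties
  using (filter-reject; filter-idem; filter-++; filter-all; filter-complete; length-filter; length-deduplicate;
         ++-identityʳ; tabulate-cong; length-tabulate; ∷-injective; ≡-dec)
open import Data.List.Membership.Propositional using (_∈_; _∉_)
open import Data.List.Membership.Propositional.Properties using (∈-tabulate⁺)
open import Data.List.Relation.Unary.All using (All; []; _∷_)
import Data.List.Relation.Unary.All.Properties as All
open import Data.List.Relation.Unary.AllPairs using ([]; _∷_)
import Data.List.Relation.Unary.AllPairs.Properties as AllPairs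
import Data.List.Relation.Unary.Any as Any
open import Data.List.Relation.Unary.Any using (here; there)
open import Data.List.Relation.Unary.Any.Properties using (lookup-index)
open import Data.List.Relation.Unary.Unique.Propositional using (Unique)
import Data.List.Relation.Unary.Unique.Propositional.Properties as Unique
open import Data.List.Relation.Unary.Unique.DecPropositional.Properties using (deduplicate-!)
import Data.Nat as ℕ
import Data.Nat.Properties as ℕ
open import Data.Product using (∃; _,_; proj₁; proj₂)
open import Data.Sum using (_⊎_; inj₁; inj₂; [_,_]′; swap)
open import Data.Unit using (⊤; tt)
open import Data.Vec.Functional using (toList; updateAt)
open import Data.Vec.Functional.Properties using (updateAt-updates; updateAt-minimal)
open import Function using (_∋_; _⇔_; mk⇔; Equivalence; Inverse; const)
open import Relation.Binary.Definitions using (DecidableEquality; Tri; tri<; tri≈; tri>)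
open import Relation.Binary.PropositionalEquality
  using (_≡_; _≗_; refl; sym; trans; cong; cong₂; subst; subst₂; module ≡-Reasoning)
open import Relation.Nullary using (Dec; yes; no; ¬?; does; contradiction)
open import Relation.Nullary.Decidable using (dec-true; dec-false; does-⇔; decidable-stable)
open import Relation.Unary using (Pred; Decidable)

-- Deduplication and the order of first occurrence

filter-comm : ∀ {a p q} {A : Set a} {P : Pred A p} {Q : Pred A q} (P? : Decidable P) (Q? : Decidable Q) xs →
              filter P? (filter Q? xs) ≡ filter Q? (filter P? xs)
filter-comm P? Q? [] = refl
filter-comm P? Q? (x ∷ xs) with does (P? x) in p | does (Q? x) in q
... | true  | true  rewrite p | q = cong (x ∷_) (filter-comm P? Q? xs)
... | true  | false rewrite q     = filter-comm P? Q? xs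
... | false | true  rewrite p     = filter-comm P? Q? xs
... | false | false               = filter-comm P? Q? xs

tabulate-∷ʳ : ∀ {A : Set} {n} (c : Tuple A (suc n)) → tabulate c ≡ tabulate (c ∘ inject₁) ∷ʳ c (fromℕ n)
tabulate-∷ʳ {n = ℕ.zero}  c = refl
tabulate-∷ʳ {n = suc n} c = cong (c zero ∷_) (tabulate-∷ʳ (c ∘ suc))

tabulate-injective : ∀ {A : Set} {n} (c d : Tuple A n) → tabulate c ≡ tabulate d → c ≗ d
tabulate-injective c d eq zero    = proj₁ (∷-injective eq)
tabulate-injective c d eq (suc x) = tabulate-injective (c ∘ suc) (d ∘ suc) (proj₂ (∷-injective eq)) x

∈-tabulate-init : ∀ {A : Set} {n} (c : Tuple A (suc n)) p → p ≢ fromℕ n → c p ∈ tabulate (c ∘ inject₁)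
∈-tabulate-init {n = n} c p p≢last = subst (λ x → c x ∈ tabulate (c ∘ inject₁)) (inject₁-lower₁ p n≢p)
                                           (∈-tabulate⁺ (lower₁ p n≢p))
  where
  n≢p : n ≢ Fin.toℕ p
  n≢p n≡p = p≢last (toℕ-injective (trans (sym n≡p) (sym (toℕ-fromℕ n))))

module _ {A : Set} (_≟ᴬ_ : DecidableEquality A) where

  private
    dedup : List A → List A
    dedup = deduplicate _≟ᴬ_

    without : A → List A → List A
    without y = filter (¬? ∘ (y ≟ᴬ_))

  without-deduplicate : ∀ y xs → without y (dedup xs) ≡ dedup (without y xs)
  without-deduplicate y [] = refl
  without-deduplicate y (x ∷ xs) with y ≟ᴬ x
  ... | yes refl = begin
    without y (without y (dedup xs)) ≡⟨ filter-idem (¬? ∘ (y ≟ᴬ_)) (dedup xs) ⟩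
    without y (dedup xs)             ≡⟨ without-deduplicate y xs ⟩
    dedup (without y xs)             ∎
    where open ≡-Reasoning
  ... | no _ = cong (x ∷_) (begin
    without y (without x (dedup xs)) ≡⟨ filter-comm (¬? ∘ (y ≟ᴬ_)) (¬? ∘ (x ≟ᴬ_)) (dedup xs) ⟩
    without x (without y (dedup xs)) ≡⟨ cong (without x) (without-deduplicate y xs) ⟩
    without x (dedup (without y xs)) ∎)
    where open ≡-Reasoning

  without-∷ʳ : ∀ y xs → without y (xs ∷ʳ y) ≡ without y xs
  without-∷ʳ y xs = begin
    without y (xs ∷ʳ y)                ≡⟨ filter-++ (¬? ∘ (y ≟ᴬ_)) xs (y ∷ []) ⟩
    without y xs ++ without y (y ∷ []) ≡⟨ cong (without y xs ++_) (filter-reject (¬? ∘ (y ≟ᴬ_)) (λ y≢y → y≢y refl)) ⟩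
    without y xs ++ []                 ≡⟨ ++-identityʳ (without y xs) ⟩
    without y xs                       ∎
    where open ≡-Reasoning

  deduplicate-∷ʳ-∈ : ∀ {x xs} → x ∈ xs → dedup (xs ∷ʳ x) ≡ dedup xs
  deduplicate-∷ʳ-∈ {x} {_ ∷ ys} (here refl) = cong (x ∷_) (begin
    without x (dedup (ys ∷ʳ x)) ≡⟨ without-deduplicate x (ys ∷ʳ x) ⟩
    dedup (without x (ys ∷ʳ x)) ≡⟨ cong dedup (without-∷ʳ x ys) ⟩
    dedup (without x ys)        ≡⟨ without-deduplicate x ys ⟨
    without x (dedup ys)        ∎)
    where open ≡-Reasoning
  deduplicate-∷ʳ-∈ {xs = y ∷ _} (there x∈ys) = cong (λ l → y ∷ without y l) (deduplicate-∷ʳ-∈ x∈ys)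

  deduplicate-Unique : ∀ {xs} → Unique xs → dedup xs ≡ xs
  deduplicate-Unique [] = refl
  deduplicate-Unique {x ∷ _} (x∉xs ∷ u) =
    cong (x ∷_) (trans (cong (without x) (deduplicate-Unique u)) (filter-all (¬? ∘ (x ≟ᴬ_)) x∉xs))

  deduplicate-length : ∀ xs → length (dedup xs) ≡ length xs → dedup xs ≡ xs
  deduplicate-length [] _ = refl
  deduplicate-length (x ∷ xs) eq = cong (x ∷_) (trans (cong (without x) dedup≡) without≡)
    where
    |without| : length (without x (dedup xs)) ≡ length xs
    |without| = ℕ.suc-injective eq
    dedup≡ : dedup xs ≡ xs
    dedup≡ = deduplicate-length xs (ℕ.≤-antisym (length-deduplicate _≟ᴬ_ xs)
      (subst (_≤ length (dedup xs)) |without| (length-filter (¬? ∘ (x ≟ᴬ_)) (dedup xs))))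
    without≡ : without x xs ≡ xs
    without≡ = filter-complete (¬? ∘ (x ≟ᴬ_)) (trans (cong (length ∘ without x) (sym dedup≡)) |without|)

  deduplicate≡⇔ : ∀ {n} {u : Tuple A n} → (∀ {x y} → u x ≡ u y → x ≡ y) →
                  ∀ a → dedup (toList a) ≡ toList u ⇔ a ≗ u
  deduplicate≡⇔ {u = u} u-injective a = mk⇔ ⇒ ⇐
    where
    ⇒ : dedup (toList a) ≡ toList u → a ≗ u
    ⇒ eq = tabulate-injective a u (trans (sym (deduplicate-length (toList a) |dedup|)) eq)
      where
      |dedup| : length (dedup (toList a)) ≡ length (toList a)
      |dedup| = trans (cong length eq) (trans (length-tabulate u) (sym (length-tabulate a)))
    ⇐ : a ≗ u → dedup (toList a) ≡ toList u
    ⇐ a≗u = trans (cong dedup (tabulate-cong a≗u)) (deduplicate-Unique (Unique.tabulate⁺ u-injective))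

  deduplicate-∷ʳ-redundant : ∀ {n} (c c′ : Tuple A (suc n)) → c ∘ inject₁ ≗ c′ ∘ inject₁ →
                             c (fromℕ n) ∈ toList (c ∘ inject₁) → c′ (fromℕ n) ∈ toList (c ∘ inject₁) →
                             dedup (toList c) ≡ dedup (toList c′)
  deduplicate-∷ʳ-redundant {n} c c′ init≗ last∈ last′∈ = begin
    dedup (toList c)                              ≡⟨ cong dedup (tabulate-∷ʳ c) ⟩
    dedup (toList (c ∘ inject₁) ∷ʳ c (fromℕ n))   ≡⟨ deduplicate-∷ʳ-∈ last∈ ⟩
    dedup (toList (c ∘ inject₁))                  ≡⟨ deduplicate-∷ʳ-∈ last′∈ ⟨
    dedup (toList (c ∘ inject₁) ∷ʳ c′ (fromℕ n))  ≡⟨ cong (λ l → dedup (l ∷ʳ c′ (fromℕ n))) (tabulate-cong init≗) ⟩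
    dedup (toList (c′ ∘ inject₁) ∷ʳ c′ (fromℕ n)) ≡⟨ cong dedup (tabulate-∷ʳ c′) ⟨
    dedup (toList c′)                             ∎
    where open ≡-Reasoning

  -- A proof of Unique is a list of negations, so without function extensionality two of them need not be
  -- equal; those built by deduplicate-! are, since every negation in them is the one returned by _≟ᴬ_.
  CanonicalAll : (x : A) (ys : List A) → All (λ y → ¬ x ≡ y) ys → Set
  CanonicalAll x []       []            = ⊤
  CanonicalAll x (y ∷ ys) (x≢y ∷ x∉ys) = x ≟ᴬ y ≡ no x≢y × CanonicalAll x ys x∉ys

  Canonical : (xs : List A) → Unique xs → Set
  Canonical []       []          = ⊤
  Canonical (x ∷ xs) (x∉xs ∷ u) = CanonicalAll x xs x∉xs × Canonical xs u

  canonicalAll-unique : ∀ x ys (p q : All (λ y → ¬ x ≡ y) ys) →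
                        CanonicalAll x ys p → CanonicalAll x ys q → p ≡ q
  canonicalAll-unique x [] [] [] _ _ = refl
  canonicalAll-unique x (y ∷ ys) (x≢y ∷ p) (_ ∷ q) (c , cs) (c′ , cs′)
    with refl ← trans (sym c) c′ = cong (x≢y ∷_) (canonicalAll-unique x ys p q cs cs′)

  canonical-unique : ∀ xs (u v : Unique xs) → Canonical xs u → Canonical xs v → u ≡ v
  canonical-unique [] [] [] _ _ = refl
  canonical-unique (x ∷ xs) (p ∷ u) (q ∷ v) (c , cs) (c′ , cs′) =
    cong₂ _∷_ (canonicalAll-unique x xs p q c c′) (canonical-unique xs u v cs cs′)

  canonicalAll-without : ∀ x ys → CanonicalAll x (without x ys) (All.all-filter (¬? ∘ (x ≟ᴬ_)) ys)
  canonicalAll-without x [] = tt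
  canonicalAll-without x (y ∷ ys) with x ≟ᴬ y in eq
  ... | yes _ = canonicalAll-without x ys
  ... | no _  = eq , canonicalAll-without x ys

  canonicalAll-filter : ∀ {p} {P : Pred A p} (P? : Decidable P) x ys (x∉ys : All (λ y → ¬ x ≡ y) ys) →
                        CanonicalAll x ys x∉ys → CanonicalAll x (filter P? ys) (All.filter⁺ P? x∉ys)
  canonicalAll-filter P? x [] [] _ = tt
  canonicalAll-filter P? x (y ∷ ys) (_ ∷ x∉ys) (c , cs) with does (P? y)
  ... | true  = c , canonicalAll-filter P? x ys x∉ys cs
  ... | false = canonicalAll-filter P? x ys x∉ys cs

  canonical-filter : ∀ {p} {P : Pred A p} (P? : Decidable P) xs (u : Unique xs) →
                     Canonical xs u → Canonical (filter P? xs) (AllPairs.filter⁺ P? u)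
  canonical-filter P? [] [] _ = tt
  canonical-filter P? (x ∷ xs) (x∉xs ∷ u) (c , cs) with does (P? x)
  ... | true  = canonicalAll-filter P? x xs x∉xs c , canonical-filter P? xs u cs
  ... | false = canonical-filter P? xs u cs

  deduplicate-!-canonical : ∀ xs → Canonical (dedup xs) (deduplicate-! _≟ᴬ_ xs)
  deduplicate-!-canonical [] = tt
  deduplicate-!-canonical (x ∷ xs) =
    canonicalAll-without x (dedup xs) ,
    canonical-filter (¬? ∘ (x ≟ᴬ_)) (dedup xs) (deduplicate-! _≟ᴬ_ xs) (deduplicate-!-canonical xs)

  ofo-≡ : ∀ {m n} (a : Tuple A m) (b : Tuple A n) →
          dedup (toList a) ≡ dedup (toList b) → ofo _≟ᴬ_ a ≡ ofo _≟ᴬ_ b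
  ofo-≡ a b eq = Σ-≡ eq (deduplicate-!-canonical (toList a)) (deduplicate-!-canonical (toList b))
    where
    Σ-≡ : ∀ {xs ys} {u : Unique xs} {v : Unique ys} → xs ≡ ys → Canonical xs u → Canonical ys v →
          (Sharp A ∋ (xs , u)) ≡ (ys , v)
    Σ-≡ {xs} {u = u} {v} refl cu cv = cong (xs ,_) (canonical-unique xs u v cu cv)

  ofo-cong : ∀ {n} {a b : Tuple A n} → a ≗ b → ofo _≟ᴬ_ a ≡ ofo _≟ᴬ_ b
  ofo-cong {a = a} {b} a≗b = ofo-≡ a b (cong dedup (tabulate-cong a≗b))

-- Maps between finite sets

punchOut-strictMono : ∀ {n} {i j k : Fin (suc n)} (i≢j : i ≢ j) (i≢k : i ≢ k) → j <ᶠ k →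
                      punchOut i≢j <ᶠ punchOut i≢k
punchOut-strictMono i≢j i≢k j<k =
  ≤∧≢⇒< (punchOut-mono-≤ i≢j i≢k (ℕ.<⇒≤ j<k)) (<⇒≢ j<k ∘ punchOut-injective i≢j i≢k)

∃∉ : ∀ {n} (xs : List (Fin n)) → length xs < n → ∃ λ w → w ∉ xs
∃∉ xs |xs|<n with all? (λ w → Any.any? (w ≟_) xs)
... | no ¬all = ¬∀⟶∃¬ _ _ (λ w → Any.any? (w ≟_) xs) ¬all
... | yes all = contradiction (injective⇒≤ index-injective) (ℕ.<⇒≱ |xs|<n)
  where
  index-injective : ∀ {v w} → Any.index (all v) ≡ Any.index (all w) → v ≡ w
  index-injective {v} {w} eq =
    trans (lookup-index (all v)) (trans (cong (lookup xs) eq) (sym (lookup-index (all w))))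

surjective⇒injective : ∀ {n} (τ : Fin n → Fin n) → (∀ y → ∃ λ x → τ x ≡ y) → ∀ {x y} → τ x ≡ τ y → x ≡ y
surjective⇒injective {suc n} τ surj {x} {y} τx≡τy with x ≟ y
... | yes x≡y = x≡y
... | no x≢y  = contradiction (injective⇒≤ section-injective) ℕ.1+n≰n
  where
  -- a section of τ avoiding x, using y instead; punching x out of it injects Fin (suc n) into Fin n
  section : Fin (suc n) → Fin (suc n)
  section z with proj₁ (surj z) ≟ x
  ... | yes _ = y
  ... | no _  = proj₁ (surj z)

  section-avoids : ∀ z → x ≢ section z
  section-avoids z with proj₁ (surj z) ≟ x
  ... | yes _   = x≢y
  ... | no p≢x = p≢x ∘ sym

  τ∘section : ∀ z → τ (section z) ≡ z
  τ∘section z with proj₁ (surj z) ≟ x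
  ... | yes p≡x = trans (sym τx≡τy) (trans (cong τ (sym p≡x)) (proj₂ (surj z)))
  ... | no _    = proj₂ (surj z)

  section-injective : ∀ {u v} → punchOut (section-avoids u) ≡ punchOut (section-avoids v) → u ≡ v
  section-injective {u} {v} eq =
    trans (sym (τ∘section u))
      (trans (cong τ (punchOut-injective (section-avoids u) (section-avoids v) eq)) (τ∘section v))

strictMono⇒≤ : ∀ {n} (φ : Fin (suc n) → Fin (suc n)) → (∀ {x y} → x <ᶠ y → φ x <ᶠ φ y) → ∀ x → x ≤ᶠ φ x
strictMono⇒≤ φ φ-mono = <-weakInduction (λ x → x ≤ᶠ φ x) ℕ.z≤n step
  where
  step : ∀ i → inject₁ i ≤ᶠ φ (inject₁ i) → suc i ≤ᶠ φ (suc i)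
  step i ih = subst (λ t → suc t ≤ Fin.toℕ (φ (suc i))) (toℕ-inject₁ i)
                (ℕ.≤-<-trans ih (φ-mono (≤̄⇒inject₁< ℕ.≤-refl)))

strictMono-permutation⇒id : ∀ {n} (σ : Permutation′ n) → (∀ {x y} → x <ᶠ y → σ ⟨$⟩ʳ x <ᶠ σ ⟨$⟩ʳ y) →
                            ∀ x → σ ⟨$⟩ʳ x ≡ x
strictMono-permutation⇒id {suc n} σ σ-mono x =
  toℕ-injective (ℕ.≤-antisym σx≤x (strictMono⇒≤ (σ ⟨$⟩ʳ_) σ-mono x))
  where
  σ⁻¹-mono : ∀ {x y} → x <ᶠ y → σ ⟨$⟩ˡ x <ᶠ σ ⟨$⟩ˡ y
  σ⁻¹-mono {x} {y} x<y with <-cmp (σ ⟨$⟩ˡ x) (σ ⟨$⟩ˡ y)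
  ... | tri< lt _ _ = lt
  ... | tri≈ _ eq _ = contradiction (trans (sym (inverseʳ σ)) (trans (cong (σ ⟨$⟩ʳ_) eq) (inverseʳ σ))) (<⇒≢ x<y)
  ... | tri> _ _ gt = contradiction (subst₂ _<ᶠ_ (inverseʳ σ) (inverseʳ σ) (σ-mono gt)) (<-asym x<y)
  σx≤x : σ ⟨$⟩ʳ x ≤ᶠ x
  σx≤x = subst (σ ⟨$⟩ʳ x ≤ᶠ_) (inverseˡ σ) (strictMono⇒≤ (σ ⟨$⟩ˡ_) σ⁻¹-mono (σ ⟨$⟩ʳ x))

⟨$⟩ʳ-injective : ∀ {n} (π : Permutation′ n) {x y} → π ⟨$⟩ʳ x ≡ π ⟨$⟩ʳ y → x ≡ y
⟨$⟩ʳ-injective π eq = trans (sym (inverseˡ π)) (trans (cong (π ⟨$⟩ˡ_) eq) (inverseˡ π))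

toFront : ∀ {n} → Fin (suc n) → Permutation′ (suc n)
toFront c = insert c zero id

toFront-self : ∀ {n} (c : Fin (suc n)) → toFront c ⟨$⟩ʳ c ≡ zero
toFront-self c with c ≟ c
... | yes _   = refl
... | no c≢c = contradiction refl c≢c

toFront-≡zero : ∀ {n} (c : Fin (suc n)) {y} → toFront c ⟨$⟩ʳ y ≡ zero → y ≡ c
toFront-≡zero c eq = ⟨$⟩ʳ-injective (toFront c) (trans eq (sym (toFront-self c)))

toFront-strictMono : ∀ {n} (c : Fin (suc n)) {u v} → c ≢ u → c ≢ v → u <ᶠ v →
                     toFront c ⟨$⟩ʳ u <ᶠ toFront c ⟨$⟩ʳ v
toFront-strictMono c {u} {v} c≢u c≢v u<v with c ≟ u | c ≟ v
... | yes c≡u | _       = contradiction c≡u c≢u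
... | no _    | yes c≡v = contradiction c≡v c≢v
... | no c≢u′ | no c≢v′ = ℕ.s≤s (punchOut-strictMono c≢u′ c≢v′ u<v)

module _ {n} (i j : Fin (suc n)) (i<j : i <ᶠ j) where

  private
    δᵢⱼ : Fin (suc n) → Fin n
    δᵢⱼ = δ i j i<j

    j≢i : j ≢ i
    j≢i = <⇒≢ i<j ∘ sym

  δ-≢ : ∀ x (j≢x : j ≢ x) → δᵢⱼ x ≡ punchOut j≢x
  δ-≢ x j≢x with x ≟ j
  ... | yes x≡j = contradiction (sym x≡j) j≢x
  ... | no _    = punchOut-cong j refl

  δ-max : δᵢⱼ j ≡ δᵢⱼ i
  δ-max with j ≟ j
  ... | yes _   = sym (δ-≢ i j≢i)
  ... | no j≢j = contradiction refl j≢j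

  δ-punchIn : ∀ y → δᵢⱼ (punchIn j y) ≡ y
  δ-punchIn y = trans (δ-≢ (punchIn j y) (punchInᵢ≢i j y ∘ sym)) (punchOut-punchIn j)

  δ-fibre-min : ∀ z → δᵢⱼ z ≡ δᵢⱼ i → z ≡ i ⊎ z ≡ j
  δ-fibre-min z eq with j ≟ z
  ... | yes j≡z = inj₂ (sym j≡z)
  ... | no j≢z  = inj₁ (punchOut-injective j≢z j≢i (trans (sym (δ-≢ z j≢z)) (trans eq (δ-≢ i j≢i))))

  δ-collision : ∀ {x y} → x <ᶠ y → δᵢⱼ x ≡ δᵢⱼ y → x ≡ i × y ≡ j
  δ-collision {x} {y} x<y eq with j ≟ x | j ≟ y
  ... | yes refl | yes refl = contradiction x<y (<-irrefl refl)
  ... | yes refl | no j≢y   = contradiction (subst (_ <ᶠ_) y≡i x<y) (<-asym i<j)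
    where
    y≡i : y ≡ i
    y≡i = punchOut-injective j≢y j≢i (trans (sym (δ-≢ y j≢y)) (trans (sym eq) (trans δ-max (δ-≢ i j≢i))))
  ... | no j≢x   | yes refl =
    punchOut-injective j≢x j≢i (trans (sym (δ-≢ x j≢x)) (trans eq (trans δ-max (δ-≢ i j≢i)))) , refl
  ... | no j≢x   | no j≢y   =
    contradiction (punchOut-injective j≢x j≢y (trans (sym (δ-≢ x j≢x)) (trans eq (δ-≢ y j≢y)))) (<⇒≢ x<y)

  δ-strictMono : ∀ {x y} → x <ᶠ y → j ≢ x → j ≢ y → δᵢⱼ x <ᶠ δᵢⱼ y
  δ-strictMono {x} {y} x<y j≢x j≢y =
    subst₂ _<ᶠ_ (sym (δ-≢ x j≢x)) (sym (δ-≢ y j≢y)) (punchOut-strictMono j≢x j≢y x<y)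

-- Special tuples

-- special i j i<j is the tuple with zeros exactly at positions i and j and the values 1, ..., m in increasing
-- order elsewhere: it is the (m+1)-tuple that moves δᵢⱼ(i) to the front, identified along δᵢⱼ.
module _ {m : ℕ} where

  special : (i j : Fin (suc (suc m))) → i <ᶠ j → Fin (suc (suc m)) → Fin (suc m)
  special i j i<j x = toFront (δ i j i<j i) ⟨$⟩ʳ δ i j i<j x

  Special : (Fin (suc (suc m)) → Fin (suc m)) → Set
  Special E = ∃ λ i → ∃ λ j → Σ (i <ᶠ j) λ i<j → E ≗ special i j i<j

  module _ (i j : Fin (suc (suc m))) (i<j : i <ᶠ j) where

    special-zeroˡ : special i j i<j i ≡ zero
    special-zeroˡ = toFront-self (δ i j i<j i)

    special-zeroʳ : special i j i<j j ≡ zero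
    special-zeroʳ = trans (cong (toFront (δ i j i<j i) ⟨$⟩ʳ_) (δ-max i j i<j)) special-zeroˡ

    special-zero : ∀ z → special i j i<j z ≡ zero → z ≡ i ⊎ z ≡ j
    special-zero z eq = δ-fibre-min i j i<j z (toFront-≡zero (δ i j i<j i) eq)

    special-collision : ∀ {x y} → x <ᶠ y → special i j i<j x ≡ special i j i<j y → x ≡ i × y ≡ j
    special-collision x<y eq = δ-collision i j i<j x<y (⟨$⟩ʳ-injective (toFront (δ i j i<j i)) eq)

    special-strictMono : ∀ {x y} → x <ᶠ y → special i j i<j x ≢ zero → special i j i<j y ≢ zero →
                         special i j i<j x <ᶠ special i j i<j y
    special-strictMono {x} {y} x<y x≢0 y≢0 =
      toFront-strictMono c (c≢δ x x≢0) (c≢δ y y≢0) (δ-strictMono i j i<j x<y (j≢ x x≢0) (j≢ y y≢0))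
      where
      c : Fin (suc m)
      c = δ i j i<j i
      c≢δ : ∀ z → special i j i<j z ≢ zero → c ≢ δ i j i<j z
      c≢δ z z≢0 c≡δz = z≢0 (trans (cong (toFront c ⟨$⟩ʳ_) (sym c≡δz)) special-zeroˡ)
      j≢ : ∀ z → special i j i<j z ≢ zero → j ≢ z
      j≢ z z≢0 refl = z≢0 special-zeroʳ

  special-irrelevant : ∀ {i j} (p q : i <ᶠ j) → special i j p ≗ special i j q
  special-irrelevant p q x = cong (λ r → special _ _ r x) (<-irrelevant p q)

  special? : ∀ E → Dec (Special E)
  special? E = any? λ i → any? λ j → pair? i j
    where
    pair? : ∀ i j → Dec (Σ (i <ᶠ j) λ i<j → E ≗ special i j i<j)
    pair? i j with i <? j
    ... | no i≮j = no (i≮j ∘ proj₁)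
    ... | yes i<j with all? (λ x → E x ≟ special i j i<j x)
    ...   | yes E≗ = yes (i<j , E≗)
    ...   | no E≇  = no λ (i<j′ , E≗) → E≇ λ x → trans (E≗ x) (special-irrelevant i<j′ i<j x)

  Special-resp : ∀ {E E′} → E ≗ E′ → Special E → Special E′
  Special-resp E≗E′ (i , j , i<j , E≗) = i , j , i<j , λ x → trans (sym (E≗E′ x)) (E≗ x)

  Special-strictMono : ∀ {E} → Special E → ∀ {x y} → x <ᶠ y → E x ≢ zero → E y ≢ zero → E x <ᶠ E y
  Special-strictMono (i , j , i<j , E≗) {x} {y} x<y x≢0 y≢0 =
    subst₂ _<ᶠ_ (sym (E≗ x)) (sym (E≗ y))
      (special-strictMono i j i<j x<y (x≢0 ∘ trans (E≗ x)) (y≢0 ∘ trans (E≗ y)))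

  Special⇒¬unique-zero : ∀ {E} → Special E → ¬ (∃ λ r → ∀ z → E z ≡ zero → z ≡ r)
  Special⇒¬unique-zero (i , j , i<j , E≗) (r , unique) =
    <⇒≢ i<j (trans (unique i (trans (E≗ i) (special-zeroˡ i j i<j)))
                   (sym (unique j (trans (E≗ j) (special-zeroʳ i j i<j)))))

  record SpecialWithZeros (x y : Fin (suc (suc m))) : Set where
    field
      tuple      : Fin (suc (suc m)) → Fin (suc m)
      isSpecial  : Special tuple
      zeroˡ      : tuple x ≡ zero
      zeroʳ      : tuple y ≡ zero
      zero⇒      : ∀ z → tuple z ≡ zero → z ≡ x ⊎ z ≡ y

  specialWithZeros : ∀ {x y} → x ≢ y → SpecialWithZeros x y
  specialWithZeros {x} {y} x≢y with <-cmp x y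
  ... | tri< x<y _ _ = record
    { tuple = special x y x<y ; isSpecial = x , y , x<y , (λ _ → refl)
    ; zeroˡ = special-zeroˡ x y x<y ; zeroʳ = special-zeroʳ x y x<y ; zero⇒ = special-zero x y x<y }
  ... | tri≈ _ x≡y _ = contradiction x≡y x≢y
  ... | tri> _ _ y<x = record
    { tuple = special y x y<x ; isSpecial = y , x , y<x , (λ _ → refl)
    ; zeroˡ = special-zeroʳ y x y<x ; zeroʳ = special-zeroˡ y x y<x
    ; zero⇒ = λ z eq → swap (special-zero y x y<x z eq) }

  Special-∘δ⇔ : ∀ i j (i<j : i <ᶠ j) (E : Fin (suc m) → Fin (suc m)) →
                Special (E ∘ (toFront (δ i j i<j i) ⟨$⟩ʳ_) ∘ δ i j i<j) ⇔ E ≗ (λ z → z)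
  Special-∘δ⇔ i j i<j E = mk⇔ ⇒ ⇐
    where
    ρ : Permutation′ (suc m)
    ρ = toFront (δ i j i<j i)
    ⇐ : E ≗ (λ z → z) → Special (E ∘ (ρ ⟨$⟩ʳ_) ∘ δ i j i<j)
    ⇐ E≗id = i , j , i<j , λ x → E≗id (special i j i<j x)
    -- a special tuple taking equal values at i and j must be special i j
    ⇒ : Special (E ∘ (ρ ⟨$⟩ʳ_) ∘ δ i j i<j) → E ≗ (λ z → z)
    ⇒ (i′ , j′ , i′<j′ , E≗) z
      with refl , refl ← special-collision i′ j′ i′<j′ i<j
             (trans (sym (E≗ i)) (trans (cong (E ∘ (ρ ⟨$⟩ʳ_)) (sym (δ-max i j i<j))) (E≗ j))) = begin
      E z                                ≡⟨ cong E (inverseʳ ρ) ⟨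
      E (ρ ⟨$⟩ʳ y)                       ≡⟨ cong (E ∘ (ρ ⟨$⟩ʳ_)) (δ-punchIn i j i<j y) ⟨
      E (ρ ⟨$⟩ʳ δ i j i<j (punchIn j y)) ≡⟨ E≗ (punchIn j y) ⟩
      special i j i′<j′ (punchIn j y)    ≡⟨ special-irrelevant i′<j′ i<j (punchIn j y) ⟩
      ρ ⟨$⟩ʳ δ i j i<j (punchIn j y)     ≡⟨ cong (ρ ⟨$⟩ʳ_) (δ-punchIn i j i<j y) ⟩
      ρ ⟨$⟩ʳ y                           ≡⟨ inverseʳ ρ ⟩
      z                                  ∎
      where
      open ≡-Reasoning
      y : Fin (suc m)
      y = ρ ⟨$⟩ˡ z

invTrivial⇒¬twoSetTransitive : ∀ {A B : Set} {n} (g : Tuple A (suc (suc (suc n))) → B) →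
                                InvTrivial g → ¬ TwoSetTransitive g
invTrivial⇒¬twoSetTransitive g trivial transitive
  with transitive zero (suc zero) zero (suc (suc zero)) (ℕ.s≤s ℕ.z≤n) (ℕ.s≤s ℕ.z≤n)
... | σ , σ∈Inv , inj₁ (_ , σ1≡2) with () ← trans (sym (trivial σ σ∈Inv (suc zero))) σ1≡2
... | σ , σ∈Inv , inj₂ (σ0≡2 , _) with () ← trans (sym (trivial σ σ∈Inv zero)) σ0≡2

-- The counterexample

module Construction (m : ℕ) (A B : Set) (e : A ↔ Fin (suc (suc m))) (b₀ b₁ : B) (b₀≢b₁ : b₀ ≢ b₁) where

  open Inverse e using (to; from; strictlyInverseˡ; strictlyInverseʳ)

  k : ℕ
  k = suc (suc m)

  _≟ᴬ_ : DecidableEquality A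
  _≟ᴬ_ = decEqVia e

  select : Bool → B
  select b = if b then b₁ else b₀

  f : Tuple A (suc k) → B
  f a = select (does (special? (to ∘ a)))

  f* : Sharp A → B
  f* (xs , _) = select (does (≡-dec _≟ᴬ_ xs (toList from)))

  from-injective : ∀ {x y} → from x ≡ from y → x ≡ y
  from-injective {x} {y} eq = trans (sym (strictlyInverseˡ x)) (trans (cong to eq) (strictlyInverseˡ y))

  Special-to∘from : ∀ {E} → Special E ⇔ Special (to ∘ from ∘ E)
  Special-to∘from = mk⇔ (Special-resp (sym ∘ strictlyInverseˡ ∘ _)) (Special-resp (strictlyInverseˡ ∘ _))

  f-cong : ∀ {a a′} → a ≗ a′ → f a ≡ f a′
  f-cong a≗a′ = cong select (does-⇔ (mk⇔ (Special-resp (cong to ∘ a≗a′)) (Special-resp (cong to ∘ sym ∘ a≗a′)))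
                                     (special? _) (special? _))

  f∘from-special : ∀ {E} → Special E → f (from ∘ E) ≡ b₁
  f∘from-special s = cong select (dec-true (special? _) (Equivalence.to Special-to∘from s))

  f∘from-nonspecial : ∀ {E} → ¬ Special E → f (from ∘ E) ≡ b₀
  f∘from-nonspecial ¬s = cong select (dec-false (special? _) (¬s ∘ Equivalence.from Special-to∘from))

  f∘from≡b₁⇒special : ∀ E → f (from ∘ E) ≡ b₁ → Special E
  f∘from≡b₁⇒special E eq = decidable-stable (special? E) λ ¬s → b₀≢b₁ (trans (sym (f∘from-nonspecial ¬s)) eq)

  module IdentificationMinor (i j : Fin (suc k)) (i<j : i <ᶠ j) where

    ρ : Permutation′ k
    ρ = toFront (δ i j i<j i)

    f*∘ofo≡minor : ∀ a → f* (ofo _≟ᴬ_ a) ≡ identMinor f i j i<j (a ∘ (ρ ⟨$⟩ʳ_))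
    f*∘ofo≡minor a = cong select (does-⇔ ofo≡⇔special (≡-dec _≟ᴬ_ _ _) (special? _))
      where
      ofo≡⇔special : deduplicate _≟ᴬ_ (toList a) ≡ toList from ⇔ Special (to ∘ a ∘ (ρ ⟨$⟩ʳ_) ∘ δ i j i<j)
      ofo≡⇔special = mk⇔
        (λ eq → Equivalence.from (Special-∘δ⇔ i j i<j (to ∘ a)) λ z →
           trans (cong to (Equivalence.to (deduplicate≡⇔ _≟ᴬ_ from-injective a) eq z)) (strictlyInverseˡ z))
        (λ s → Equivalence.from (deduplicate≡⇔ _≟ᴬ_ from-injective a) λ z →
           trans (sym (strictlyInverseʳ (a z))) (cong from (Equivalence.to (Special-∘δ⇔ i j i<j (to ∘ a)) s z)))

    minor≡f*∘ofo : ∀ a → identMinor f i j i<j a ≡ f* (ofo _≟ᴬ_ (a ∘ (ρ ⟨$⟩ˡ_)))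
    minor≡f*∘ofo a = trans (f-cong λ x → cong a (sym (inverseˡ ρ))) (sym (f*∘ofo≡minor (a ∘ (ρ ⟨$⟩ˡ_))))

    equivalent : Equivalent (identMinor f i j i<j) (f* ∘ ofo _≟ᴬ_ {k})
    equivalent = ((ρ ⟨$⟩ˡ_) , minor≡f*∘ofo) , ((ρ ⟨$⟩ʳ_) , f*∘ofo≡minor)

  module Spoiled (q : Fin (suc k)) where

    r : Fin (suc k)
    r = proj₁ (∃∉ (q ∷ []) (ℕ.s≤s (ℕ.s≤s ℕ.z≤n)))

    r≢q : r ≢ q
    r≢q r≡q = proj₂ (∃∉ (q ∷ []) (ℕ.s≤s (ℕ.s≤s ℕ.z≤n))) (here r≡q)

    w : Fin (suc k)
    w = proj₁ (∃∉ (q ∷ r ∷ []) (ℕ.s≤s (ℕ.s≤s (ℕ.s≤s ℕ.z≤n))))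

    w∉qr : w ∉ q ∷ r ∷ []
    w∉qr = proj₂ (∃∉ (q ∷ r ∷ []) (ℕ.s≤s (ℕ.s≤s (ℕ.s≤s ℕ.z≤n))))

    open SpecialWithZeros (specialWithZeros (r≢q ∘ sym)) public renaming (tuple to E)

    E′ : Fin (suc k) → Fin k
    E′ = updateAt E q (const (E w))

    E′-q : E′ q ≡ E w
    E′-q = updateAt-updates q E

    E′-≢q : ∀ x → x ≢ q → E′ x ≡ E x
    E′-≢q x x≢q = updateAt-minimal x q E x≢q

    E′-nonspecial : ¬ Special E′
    E′-nonspecial s = Special⇒¬unique-zero s (r , only-r)
      where
      only-r : ∀ z → E′ z ≡ zero → z ≡ r
      only-r z E′z≡0 = by-cases (z ≟ q)
        where
        by-cases : Dec (z ≡ q) → z ≡ r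
        by-cases (yes z≡q) = contradiction (zero⇒ w (trans (sym E′-q) (trans (cong E′ (sym z≡q)) E′z≡0)))
                                           [ w∉qr ∘ here , w∉qr ∘ there ∘ here ]′
        by-cases (no z≢q)  = [ (λ z≡q → contradiction z≡q z≢q) , (λ z≡r → z≡r) ]′
                               (zero⇒ z (trans (sym (E′-≢q z z≢q)) E′z≡0))

    ofo-≡-missed : ∀ (τ : Fin (suc k) → Fin (suc k)) → ¬ (∃ λ p → τ p ≡ q) →
                   ofo _≟ᴬ_ (from ∘ E ∘ τ) ≡ ofo _≟ᴬ_ (from ∘ E′ ∘ τ)
    ofo-≡-missed τ q∉τ = ofo-cong _≟ᴬ_ λ x → cong from (sym (E′-≢q (τ x) λ τx≡q → q∉τ (x , τx≡q)))

    -- a bijective τ reads position q only last, and both values it may find there already occur earlier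
    ofo-≡-last : ∀ (τ : Fin (suc k) → Fin (suc k)) → (∀ y → ∃ λ x → τ x ≡ y) → τ (fromℕ k) ≡ q →
                 ofo _≟ᴬ_ (from ∘ E ∘ τ) ≡ ofo _≟ᴬ_ (from ∘ E′ ∘ τ)
    ofo-≡-last τ surjective τlast≡q = ofo-≡ _≟ᴬ_ c c′
      (deduplicate-∷ʳ-redundant _≟ᴬ_ c c′ init≗ (earlier r r≢q E-last) (earlier w (w∉qr ∘ here) E′-last))
      where
      c c′ : Tuple A (suc k)
      c  = from ∘ E ∘ τ
      c′ = from ∘ E′ ∘ τ
      init≗ : c ∘ inject₁ ≗ c′ ∘ inject₁
      init≗ y = cong from (sym (E′-≢q _ λ τy≡q →
        fromℕ≢inject₁ (surjective⇒injective τ surjective (trans τlast≡q (sym τy≡q)))))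
      earlier : ∀ t → t ≢ q → ∀ {v} → E t ≡ v → from v ∈ toList (c ∘ inject₁)
      earlier t t≢q Et≡v = subst (_∈ toList (c ∘ inject₁)) (cong from (trans (cong E τp≡t) Et≡v))
                             (∈-tabulate-init c p λ p≡last →
                                t≢q (trans (sym τp≡t) (trans (cong τ p≡last) τlast≡q)))
        where
        p : Fin (suc k)
        p = proj₁ (surjective t)
        τp≡t : τ p ≡ t
        τp≡t = proj₂ (surjective t)
      E-last : E r ≡ E (τ (fromℕ k))
      E-last = trans zeroʳ (sym (trans (cong E τlast≡q) zeroˡ))
      E′-last : E w ≡ E′ (τ (fromℕ k))
      E′-last = trans (sym E′-q) (cong E′ (sym τlast≡q))

  ofo-differs : ∀ (τ : Fin (suc k) → Fin (suc k)) (h : Sharp A → B) → (∀ a → f a ≡ h (ofo _≟ᴬ_ (a ∘ τ))) →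
                ∀ {E E′} → Special E → ¬ Special E′ → ofo _≟ᴬ_ (from ∘ E ∘ τ) ≢ ofo _≟ᴬ_ (from ∘ E′ ∘ τ)
  ofo-differs τ h f≗ {E} {E′} s ¬s′ eq = b₀≢b₁ (begin
    b₀                            ≡⟨ f∘from-nonspecial ¬s′ ⟨
    f (from ∘ E′)                 ≡⟨ f≗ (from ∘ E′) ⟩
    h (ofo _≟ᴬ_ (from ∘ E′ ∘ τ))  ≡⟨ cong h eq ⟨
    h (ofo _≟ᴬ_ (from ∘ E ∘ τ))   ≡⟨ f≗ (from ∘ E) ⟨
    f (from ∘ E)                  ≡⟨ f∘from-special s ⟩
    b₁                            ∎)
    where open ≡-Reasoning

  f-not-ofo∘minor : ∀ (τ : Fin (suc k) → Fin (suc k)) (h : Sharp A → B) → ¬ (∀ a → f a ≡ h (ofo _≟ᴬ_ (a ∘ τ)))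
  f-not-ofo∘minor τ h f≗ = by-surjectivity (all? (λ q → any? (λ p → τ p ≟ q)))
    where
    by-surjectivity : Dec (∀ q → ∃ λ p → τ p ≡ q) → ⊥
    by-surjectivity (yes surjective) = ofo-differs τ h f≗ isSpecial E′-nonspecial (ofo-≡-last τ surjective refl)
      where open Spoiled (τ (fromℕ k))
    by-surjectivity (no ¬surjective) = missed (¬∀⟶∃¬ _ _ (λ q → any? (λ p → τ p ≟ q)) ¬surjective)
      where
      missed : (∃ λ q → ¬ ∃ λ p → τ p ≡ q) → ⊥
      missed (q , q∉τ) = ofo-differs τ h f≗ isSpecial E′-nonspecial (ofo-≡-missed τ q∉τ)
        where open Spoiled q

  ¬equivalent-determinedByOfo : ¬ Σ (Tuple A (suc k) → B) λ g → DeterminedByOfo _≟ᴬ_ g × Equivalent f g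
  ¬equivalent-determinedByOfo (g , (g* , g≗) , (τ , f≗) , _) =
    f-not-ofo∘minor τ g* (λ a → trans (f≗ a) (g≗ (a ∘ τ)))

  invTrivial : 2 < k → InvTrivial f
  invTrivial 2<k σ σ∈Inv = strictMono-permutation⇒id σ σ-strictMono
    where
    Special-∘σ : ∀ {E} → Special E → Special (E ∘ (σ ⟨$⟩ʳ_))
    Special-∘σ {E} s = f∘from≡b₁⇒special _ (trans (sym (σ∈Inv (from ∘ E))) (f∘from-special s))

    -- compare a special tuple whose zeros avoid σ x and σ y with its (special) image under σ
    σ-strictMono : ∀ {x y} → x <ᶠ y → σ ⟨$⟩ʳ x <ᶠ σ ⟨$⟩ʳ y
    σ-strictMono {x} {y} x<y = compare (<-cmp σx σy)
      where
      σx σy : Fin (suc k)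
      σx = σ ⟨$⟩ʳ x
      σy = σ ⟨$⟩ʳ y
      u v : Fin (suc k)
      u = proj₁ (∃∉ (σx ∷ σy ∷ []) (ℕ.m≤n⇒m≤1+n 2<k))
      v = proj₁ (∃∉ (σx ∷ σy ∷ u ∷ []) (ℕ.s≤s 2<k))
      u∉ : u ∉ σx ∷ σy ∷ []
      u∉ = proj₂ (∃∉ (σx ∷ σy ∷ []) (ℕ.m≤n⇒m≤1+n 2<k))
      v∉ : v ∉ σx ∷ σy ∷ u ∷ []
      v∉ = proj₂ (∃∉ (σx ∷ σy ∷ u ∷ []) (ℕ.s≤s 2<k))
      open SpecialWithZeros (specialWithZeros λ u≡v → v∉ (there (there (here (sym u≡v)))))
        renaming (tuple to E)
      nonzero : ∀ z → z ≢ u → z ≢ v → E z ≢ zero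
      nonzero z z≢u z≢v Ez≡0 = [ z≢u , z≢v ]′ (zero⇒ z Ez≡0)
      Eσx≢0 : E σx ≢ zero
      Eσx≢0 = nonzero σx (λ σx≡u → u∉ (here (sym σx≡u))) (λ σx≡v → v∉ (here (sym σx≡v)))
      Eσy≢0 : E σy ≢ zero
      Eσy≢0 = nonzero σy (λ σy≡u → u∉ (there (here (sym σy≡u)))) (λ σy≡v → v∉ (there (here (sym σy≡v))))
      Eσx<Eσy : E σx <ᶠ E σy
      Eσx<Eσy = Special-strictMono (Special-∘σ isSpecial) x<y Eσx≢0 Eσy≢0
      compare : Tri (σx <ᶠ σy) (σx ≡ σy) (σy <ᶠ σx) → σx <ᶠ σy
      compare (tri< σx<σy _ _) = σx<σy
      compare (tri≈ _ σx≡σy _) = contradiction (cong E σx≡σy) (<⇒≢ Eσx<Eσy)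
      compare (tri> _ _ σy<σx) = contradiction (Special-strictMono isSpecial σy<σx Eσy≢0 Eσx≢0) (<-asym Eσx<Eσy)

proposition4p2 : (k : ℕ) → 2 ≤ k → (A B : Set) → (e : A ↔ Fin k) →
    (b₀ b₁ : B) → b₀ ≢ b₁ →
    Σ (Tuple A (suc k) → B) λ f → Σ (Sharp A → B) λ fstar →
      (∀ (i j : Fin (suc k)) (i<j : i <ᶠ j) →
         Equivalent (identMinor f i j i<j) (fstar ∘ ofo (decEqVia e) {k}))
      × (¬ Σ (Tuple A (suc k) → B) λ g →
             DeterminedByOfo (decEqVia e) g × Equivalent f g)
      × (2 < k → InvTrivial f × ¬ TwoSetTransitive f)
proposition4p2 (suc ℕ.zero) (ℕ.s≤s ()) _ _ _ _ _ _
proposition4p2 (suc (suc m)) _ A B e b₀ b₁ b₀≢b₁ =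
  f , f* , IdentificationMinor.equivalent , ¬equivalent-determinedByOfo ,
  λ 2<k → invTrivial 2<k , invTrivial⇒¬twoSetTransitive f (invTrivial 2<k)
  where open Construction m A B e b₀ b₁ b₀≢b₁
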